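{- Let $A,B$ be two distinct letters. For all non-negative integers $p,q$, in $\mathbb{Q}\langle A,B\rangle$ we have \[ (AB)^p \,\text{ш}\, (AB)^q=\sum_{j=0}^{\min(p,q)} 4^j\binom{p+q-2j}{p-j}\,T_{p+q,j}. \]
   Context: $\mathbb{Q}\langle A,B\rangle$ is the $\mathbb{Q}$-vector space with basis all words (finite, possibly empty, sequences of letters) over the alphabet $\{A,B\}$; $w^k$ denotes $k$ consecutive copies of the word $w$. The shuffle product ш is the bilinear operation defined on words $u=x_1\cdots x_n$, $v=x_{n+1}\cdots x_{n+m}$ by $u\,\text{ш}\,v=\sum_\sigma x_{\sigma(1)}x_{\sigma(2)}\cdots x_{\sigma(n+m)}$, the sum over all permutations $\sigma$ of $\{1,\ldots,n+m\}$ with $\sigma^{ -1}(j)<\sigma^{ -1}(k)$ whenever $1\le j<k\le n$ or $n+1\le j<k\le n+m$ (counted with multiplicity). For non-negative integers $p,q,j$ with $\min(p,q)\ge j$, $S_{p+q,j}$ is the set of distinct words occurring (with nonzero coefficient) in $(AB)^p\,\text{ш}\,(AB)^q$ which contain the factor $AA$ exactly $j$ times (i.e. there are exactly $j$ positions $i$ such that the $i$-th and $(i+1)$-th letters are both $A$); this set depends only on $p+q$ and $j$. $T_{p+q,j}$ denotes the sum (each word with coefficient $1$) of all words in $S_{p+q,j}$. -}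

module Defs where

open import Data.Nat as ℕ using (ℕ; zero; suc; _∸_; _⊔_; _⊓_)
open import Data.Nat.Combinatorics using (_C_)
open import Data.Integer using (+_)
open import Data.Rational using (ℚ; 0ℚ; 1ℚ; _+_; _*_; _/_)
open import Data.List using (List; []; _∷_; map; _++_; upTo; foldr)
open import Data.List.Properties using (≡-dec)
open import Data.List.Relation.Unary.Any using (any?)
open import Data.Bool using (Bool; true; false; if_then_else_; _∧_)
open import Relation.Nullary using (Dec; yes; no; does)
open import Relation.Binary.PropositionalEquality using (_≡_; refl)
open import Relation.Binary.Definitions using (DecidableEquality)

data Letter : Set where
  A B : Letter

_≟L_ : DecidableEquality Letter
A ≟L A = yes refl
A ≟L B = no λ ()
B ≟L A = no λ ()
B ≟L B = yes refl

Word : Set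
Word = List Letter

_≟W_ : DecidableEquality Word
_≟W_ = ≡-dec _≟L_

_^ʷ_ : Word → ℕ → Word
w ^ʷ zero  = []
w ^ʷ suc k = w ++ (w ^ʷ k)

AB : Word
AB = A ∷ B ∷ []

-- Elements of ℚ⟨A,B⟩, represented by their coefficient function
-- (the coefficient of each word).  Equality of polynomials is
-- equality of all coefficients.
Poly : Set
Poly = Word → ℚ

_≐_ : Poly → Poly → Set
f ≐ g = ∀ w → f w ≡ g w

infix 4 _≐_

0P : Poly
0P _ = 0ℚ

_⊕_ : Poly → Poly → Poly
(f ⊕ g) w = f w + g w

infixl 6 _⊕_

_·_ : ℚ → Poly → Poly
(c · f) w = c * f w

infixl 7 _·_

ℕ→ℚ : ℕ → ℚ
ℕ→ℚ n = + n / 1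

Σ[j≤_]_ : ℕ → (ℕ → Poly) → Poly
Σ[j≤ n ] f = foldr (λ j acc → f j ⊕ acc) 0P (upTo (suc n))

-- The list (with multiplicity) of all words x_{σ(1)}⋯x_{σ(n+m)} over
-- shuffle permutations σ of u and v (standard recursive description).
shuffles : Word → Word → List Word
shuffles []      v       = v ∷ []
shuffles (x ∷ u) []      = (x ∷ u) ∷ []
shuffles (x ∷ u) (y ∷ v) = map (x ∷_) (shuffles u (y ∷ v)) ++ map (y ∷_) (shuffles (x ∷ u) v)

count : Word → List Word → ℕ
count w []       = zero
count w (u ∷ us) = if does (w ≟W u) then suc (count w us) else count w us

_ш_ : Word → Word → Poly
(u ш v) w = ℕ→ℚ (count w (shuffles u v))

countAA : Word → ℕ
countAA []            = zero
countAA (A ∷ A ∷ w)   = suc (countAA (A ∷ w))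
countAA (_ ∷ w)       = countAA w

occurs : ℕ → ℕ → Word → Bool
occurs p q w = does (any? (w ≟W_) (shuffles (AB ^ʷ p) (AB ^ʷ q)))

-- S_{p+q,j} as a decidable predicate on words: the distinct words
-- occurring in (AB)^p ш (AB)^q containing the factor AA exactly j times.
inS : ℕ → ℕ → ℕ → Word → Bool
inS p q j w = occurs p q w ∧ does (countAA w ℕ.≟ j)

T : ℕ → ℕ → ℕ → Poly
T p q j w = if inS p q j w then 1ℚ else 0ℚ

-- Fix w and collect its coefficients in (AB)ᵖ ш (AB)^q, for all p and q, into a power
-- series in x and y.  While w is read, each factor either starts a fresh AB or owes the B
-- of its current one, and the series of these states obey linear recursions: an AB read
-- with no B owed multiplies by x + y; an AA makes both factors owe a B and, in either
-- order, multiplies by 2xy; each descent to one owed B and back multiplies by x + y; the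
-- final B may come from either factor, a further factor 2.  So by induction on w the series
-- is 0 or (4xy)^c (x+y)^m with c = countAA w, whose coefficient at (p, q) is
-- 4^c C(p+q−2c, p−c), and on the right only the summand j = countAA w survives.
module Submission where

open import Defs
open import Data.Nat using (ℕ; _+_; _*_; _∸_; _^_; _⊓_)
open import Data.Nat.Combinatorics using (_C_)

open import Data.Nat using (zero; suc; _≤_; z≤n; s≤s; _≟_)
open import Data.Nat.Properties
  using (+-identityʳ; *-identityˡ; *-zeroʳ; *-assoc; *-distribˡ-+; +-suc; *-suc; suc-injective)
open import Data.Nat.Combinatorics using (nCn≡1; nCk+nC[k+1]≡[n+1]C[k+1])
open import Data.Rational as ℚ using (0ℚ; 1ℚ)
import Data.Rational.Properties as ℚₚ
open import Data.List using (List; []; _∷_; map; _++_; upTo; applyUpTo; foldr)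
open import Data.List.Properties using (∷-injectiveˡ; ∷-injectiveʳ; foldr-map; map-upTo)
open import Data.List.Relation.Unary.Any using (Any; here; there; any?)
open import Data.Bool using (true; false; if_then_else_; _∧_)
open import Data.Product using (_×_; _,_; map₂)
open import Function using (_∘_)
open import Function.Definitions using (Injective)
open import Relation.Nullary using (¬_; Dec; yes; no; does; contradiction)
open import Relation.Nullary.Decidable using (dec-true; dec-false)
open import Relation.Binary.PropositionalEquality
  using (_≡_; _≢_; refl; sym; trans; cong; cong₂; module ≡-Reasoning)
open ≡-Reasoning

count-++ : ∀ w xs ys → count w (xs ++ ys) ≡ count w xs + count w ys
count-++ w []       ys = refl
count-++ w (x ∷ xs) ys with w ≟W x
... | yes _ = cong suc (count-++ w xs ys)
... | no  _ = count-++ w xs ys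

count-map-injective : ∀ {f : Word → Word} → Injective _≡_ _≡_ f →
                      ∀ w L → count (f w) (map f L) ≡ count w L
count-map-injective         f-inj w []      = refl
count-map-injective {f = f} f-inj w (l ∷ L) with f w ≟W f l | w ≟W l
... | yes _     | yes _   = cong suc (count-map-injective f-inj w L)
... | no  _     | no  _   = count-map-injective f-inj w L
... | yes fw≡fl | no w≢l  = contradiction (f-inj fw≡fl) w≢l
... | no  fw≢fl | yes w≡l = contradiction (cong f w≡l) fw≢fl

count-map-outside : ∀ {w} {f : Word → Word} → (∀ u → w ≢ f u) → ∀ L → count w (map f L) ≡ 0
count-map-outside             w∉f []      = refl
count-map-outside {w} {f} w∉f (l ∷ L) with w ≟W f l
... | yes w≡fl = contradiction w≡fl (w∉f l)
... | no  _    = count-map-outside w∉f L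

count-∷-map : ∀ x y w L →
              count (x ∷ w) (map (y ∷_) L) ≡ (if does (x ≟L y) then count w L else 0)
count-∷-map x y w L with x ≟L y
... | yes refl = count-map-injective ∷-injectiveʳ w L
... | no  x≢y  = count-map-outside (λ u → x≢y ∘ ∷-injectiveˡ) L

count-[]-map : ∀ y L → count [] (map (y ∷_) L) ≡ 0
count-[]-map y = count-map-outside (λ u ())

count≢0⇒∈ : ∀ {w} L → count w L ≢ 0 → Any (w ≡_) L
count≢0⇒∈ []          n≢0 = contradiction refl n≢0
count≢0⇒∈ {w} (u ∷ L) n≢0 with w ≟W u
... | yes w≡u = here w≡u
... | no  _   = there (count≢0⇒∈ L n≢0)

count≡0⇒∉ : ∀ {w} L → count w L ≡ 0 → ¬ Any (w ≡_) L
count≡0⇒∉ {w} (u ∷ L) n≡0 w∈ with w ≟W u | w∈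
... | yes _   | _          = contradiction n≡0 λ ()
... | no  w≢u | here w≡u   = w≢u w≡u
... | no  _   | there w∈L  = count≡0⇒∉ L n≡0 w∈L

shuffles-[]ʳ : ∀ u → shuffles u [] ≡ u ∷ []
shuffles-[]ʳ []      = refl
shuffles-[]ʳ (x ∷ u) = refl

mult : Word → Word → Word → ℕ
mult w u v = count w (shuffles u v)

whenHead : Letter → Word → (Word → ℕ) → ℕ
whenHead x []      k = 0
whenHead x (y ∷ u) k = if does (x ≟L y) then k u else 0

mult-∷ : ∀ x w u v → mult (x ∷ w) u v ≡
         whenHead x u (λ u′ → mult w u′ v) + whenHead x v (λ v′ → mult w u v′)
mult-∷ x w []      []      = refl
mult-∷ x w []      (y ∷ v) = count-∷-map x y w (v ∷ [])
mult-∷ x w (y ∷ u) []      = begin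
  count (x ∷ w) ((y ∷ u) ∷ [])                    ≡⟨ count-∷-map x y w (u ∷ []) ⟩
  branch (u ∷ [])                                 ≡⟨ cong branch (shuffles-[]ʳ u) ⟨
  whenHead x (y ∷ u) (λ u′ → mult w u′ [])        ≡⟨ +-identityʳ _ ⟨
  whenHead x (y ∷ u) (λ u′ → mult w u′ []) + 0    ∎
  where branch : List Word → ℕ
        branch L = if does (x ≟L y) then count w L else 0
mult-∷ x w (y ∷ u) (z ∷ v) =
  trans (count-++ (x ∷ w) (map (y ∷_) (shuffles u (z ∷ v))) (map (z ∷_) (shuffles (y ∷ u) v)))
        (cong₂ _+_ (count-∷-map x y w (shuffles u (z ∷ v)))
                   (count-∷-map x z w (shuffles (y ∷ u) v)))

mult-[]-∷ˡ : ∀ x u v → mult [] (x ∷ u) v ≡ 0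
mult-[]-∷ˡ x u []      = refl
mult-[]-∷ˡ x u (y ∷ v) =
  trans (count-++ [] (map (x ∷_) (shuffles u (y ∷ v))) (map (y ∷_) (shuffles (x ∷ u) v)))
        (cong₂ _+_ (count-[]-map x (shuffles u (y ∷ v))) (count-[]-map y (shuffles (x ∷ u) v)))

mult-[]-∷ʳ : ∀ x u v → mult [] u (x ∷ v) ≡ 0
mult-[]-∷ʳ x []      v = refl
mult-[]-∷ʳ x (y ∷ u) v = mult-[]-∷ˡ y u (x ∷ v)

-- A table F stands for the power series Σ F a b xᵃ yᵇ, whence the names below.
Table : Set
Table = ℕ → ℕ → ℕ

infix  4 _≋_
infixr 6 _⊞_
infixr 7 _⋆_
infixr 8 x·_ y·_ [x+y]·_ [x+y]^_ [4xy]^_[x+y]^_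

_≋_ : Table → Table → Set
F ≋ G = ∀ a b → F a b ≡ G a b

0ₜ 1ₜ : Table
0ₜ _ _ = 0
1ₜ zero zero = 1
1ₜ _    _    = 0

_⊞_ : Table → Table → Table
(F ⊞ G) a b = F a b + G a b

_⋆_ : ℕ → Table → Table
(k ⋆ F) a b = k * F a b

shift : (ℕ → ℕ) → ℕ → ℕ
shift f zero    = 0
shift f (suc n) = f n

x·_ y·_ [x+y]·_ : Table → Table
(x· F) a b = shift (λ a′ → F a′ b) a
(y· F) a b = shift (F a) b
[x+y]· F   = x· F ⊞ y· F

[x+y]^_ : ℕ → Table
[x+y]^ zero  = 1ₜ
[x+y]^ suc m = [x+y]· [x+y]^ m

[4xy]^_[x+y]^_ : ℕ → ℕ → Table
[4xy]^ zero  [x+y]^ m = [x+y]^ m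
[4xy]^ suc c [x+y]^ m = 4 ⋆ x· y· [4xy]^ c [x+y]^ m

x·-cong : ∀ {F G} → F ≋ G → x· F ≋ x· G
x·-cong F≋G zero    b = refl
x·-cong F≋G (suc a) b = F≋G a b

y·-cong : ∀ {F G} → F ≋ G → y· F ≋ y· G
y·-cong F≋G a zero    = refl
y·-cong F≋G a (suc b) = F≋G a b

[x+y]·-cong : ∀ {F G} → F ≋ G → [x+y]· F ≋ [x+y]· G
[x+y]·-cong F≋G a b = cong₂ _+_ (x·-cong F≋G a b) (y·-cong F≋G a b)

x·-0 : ∀ {F} → F ≋ 0ₜ → x· F ≋ 0ₜ
x·-0 F≋0 zero    b = refl
x·-0 F≋0 (suc a) b = F≋0 a b

y·-0 : ∀ {F} → F ≋ 0ₜ → y· F ≋ 0ₜ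
y·-0 F≋0 a zero    = refl
y·-0 F≋0 a (suc b) = F≋0 a b

[x+y]·-0 : ∀ {F} → F ≋ 0ₜ → [x+y]· F ≋ 0ₜ
[x+y]·-0 F≋0 a b = cong₂ _+_ (x·-0 F≋0 a b) (y·-0 F≋0 a b)

x·-⋆ : ∀ k F → x· (k ⋆ F) ≋ k ⋆ x· F
x·-⋆ k F zero    b = sym (*-zeroʳ k)
x·-⋆ k F (suc a) b = refl

y·-⋆ : ∀ k F → y· (k ⋆ F) ≋ k ⋆ y· F
y·-⋆ k F a zero    = sym (*-zeroʳ k)
y·-⋆ k F a (suc b) = refl

[x+y]·-⋆ : ∀ k F → [x+y]· (k ⋆ F) ≋ k ⋆ [x+y]· F
[x+y]·-⋆ k F a b =
  trans (cong₂ _+_ (x·-⋆ k F a b) (y·-⋆ k F a b)) (sym (*-distribˡ-+ k _ _))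

y·x·≋x·y· : ∀ F → y· x· F ≋ x· y· F
y·x·≋x·y· F zero    zero    = refl
y·x·≋x·y· F zero    (suc b) = refl
y·x·≋x·y· F (suc a) zero    = refl
y·x·≋x·y· F (suc a) (suc b) = refl

[x+y]·x·y·≋x·y·[x+y]· : ∀ F → [x+y]· x· y· F ≋ x· y· [x+y]· F
[x+y]·x·y·≋x·y·[x+y]· F zero          zero          = refl
[x+y]·x·y·≋x·y·[x+y]· F zero          (suc zero)    = refl
[x+y]·x·y·≋x·y·[x+y]· F zero          (suc (suc b)) = refl
[x+y]·x·y·≋x·y·[x+y]· F (suc zero)    zero          = refl
[x+y]·x·y·≋x·y·[x+y]· F (suc zero)    (suc zero)    = refl
[x+y]·x·y·≋x·y·[x+y]· F (suc zero)    (suc (suc b)) = refl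
[x+y]·x·y·≋x·y·[x+y]· F (suc (suc a)) zero          = refl
[x+y]·x·y·≋x·y·[x+y]· F (suc (suc a)) (suc zero)    = refl
[x+y]·x·y·≋x·y·[x+y]· F (suc (suc a)) (suc (suc b)) = refl

[x+y]·[4xy]^[x+y]^ : ∀ c m → [x+y]· [4xy]^ c [x+y]^ m ≋ [4xy]^ c [x+y]^ suc m
[x+y]·[4xy]^[x+y]^ zero    m a b = refl
[x+y]·[4xy]^[x+y]^ (suc c) m a b = begin
  ([x+y]· (4 ⋆ x· y· G)) a b     ≡⟨ [x+y]·-⋆ 4 (x· y· G) a b ⟩
  (4 ⋆ [x+y]· x· y· G) a b       ≡⟨ cong (4 *_) ([x+y]·x·y·≋x·y·[x+y]· G a b) ⟩
  (4 ⋆ x· y· [x+y]· G) a b       ≡⟨ cong (4 *_) (x·-cong (y·-cong IH) a b) ⟩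
  ([4xy]^ suc c [x+y]^ suc m) a b ∎
  where G : Table
        G = [4xy]^ c [x+y]^ m
        IH : [x+y]· G ≋ [4xy]^ c [x+y]^ suc m
        IH = [x+y]·[4xy]^[x+y]^ c m

[x+y]^-support : ∀ m a b → ([x+y]^ m) a b ≢ 0 → a + b ≡ m
[x+y]^-support zero    zero    zero    _   = refl
[x+y]^-support zero    zero    (suc b) ≢0  = contradiction refl ≢0
[x+y]^-support zero    (suc a) b       ≢0  = contradiction refl ≢0
[x+y]^-support (suc m) zero    zero    ≢0  = contradiction refl ≢0
[x+y]^-support (suc m) zero    (suc b) ≢0  = cong suc ([x+y]^-support m zero b ≢0)
[x+y]^-support (suc m) (suc a) zero    ≢0  =
  cong suc ([x+y]^-support m a zero (≢0 ∘ trans (+-identityʳ _)))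
[x+y]^-support (suc m) (suc a) (suc b) ≢0 with ([x+y]^ m) a (suc b) ≟ 0
... | no  ≢0′ = cong suc ([x+y]^-support m a (suc b) ≢0′)
... | yes ≡0  = cong suc (trans (+-suc a b) ([x+y]^-support m (suc a) b (≢0 ∘ cong₂ _+_ ≡0)))

[x+y]^-coefficient : ∀ m a b → a + b ≡ m → ([x+y]^ m) a b ≡ m C a
[x+y]^-coefficient zero    zero    zero    refl = refl
[x+y]^-coefficient (suc m) zero    (suc b) eq   = [x+y]^-coefficient m zero b (suc-injective eq)
[x+y]^-coefficient (suc m) (suc a) zero    eq   = begin
  ([x+y]^ m) a 0 + 0 ≡⟨ +-identityʳ _ ⟩
  ([x+y]^ m) a 0     ≡⟨ [x+y]^-coefficient m a 0 (suc-injective eq) ⟩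
  m C a              ≡⟨ cong (m C_) a≡m ⟩
  m C m              ≡⟨ nCn≡1 m ⟩
  1                  ≡⟨ nCn≡1 (suc m) ⟨
  suc m C suc m      ≡⟨ cong (λ k → suc m C suc k) a≡m ⟨
  suc m C suc a      ∎
  where a≡m : a ≡ m
        a≡m = trans (sym (+-identityʳ a)) (suc-injective eq)
[x+y]^-coefficient (suc m) (suc a) (suc b) eq =
  trans (cong₂ _+_ ([x+y]^-coefficient m a (suc b) (suc-injective eq))
                   ([x+y]^-coefficient m (suc a) b (trans (sym (+-suc a b)) (suc-injective eq))))
        (nCk+nC[k+1]≡[n+1]C[k+1] m a)

[1+a]+[1+b]∸2*[1+c]≡a+b∸2*c : ∀ a b c → suc a + suc b ∸ 2 * suc c ≡ a + b ∸ 2 * c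
[1+a]+[1+b]∸2*[1+c]≡a+b∸2*c a b c = cong₂ _∸_ (cong suc (+-suc a b)) (*-suc 2 c)

[4xy]^[x+y]^-coefficient : ∀ c m a b → ([4xy]^ c [x+y]^ m) a b ≢ 0 →
  c ≤ a ⊓ b × ([4xy]^ c [x+y]^ m) a b ≡ 4 ^ c * ((a + b ∸ 2 * c) C (a ∸ c))
[4xy]^[x+y]^-coefficient zero m a b ≢0 = z≤n , (begin
  ([x+y]^ m) a b   ≡⟨ [x+y]^-coefficient m a b a+b≡m ⟩
  m C a            ≡⟨ cong (_C a) a+b≡m ⟨
  (a + b) C a      ≡⟨ *-identityˡ _ ⟨
  1 * ((a + b) C a) ∎)
  where a+b≡m : a + b ≡ m
        a+b≡m = [x+y]^-support m a b ≢0
[4xy]^[x+y]^-coefficient (suc c) m zero    b       ≢0 = contradiction refl ≢0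
[4xy]^[x+y]^-coefficient (suc c) m (suc a) zero    ≢0 = contradiction refl ≢0
[4xy]^[x+y]^-coefficient (suc c) m (suc a) (suc b) ≢0
  with [4xy]^[x+y]^-coefficient c m a b (≢0 ∘ cong (4 *_))
... | c≤a⊓b , G≡ = s≤s c≤a⊓b , (begin
  4 * G a b                                     ≡⟨ cong (4 *_) G≡ ⟩
  4 * (4 ^ c * ((a + b ∸ 2 * c) C (a ∸ c)))     ≡⟨ *-assoc 4 (4 ^ c) _ ⟨
  4 ^ suc c * ((a + b ∸ 2 * c) C (a ∸ c))       ≡⟨ cong (λ n → 4 ^ suc c * (n C (a ∸ c)))
                                                        ([1+a]+[1+b]∸2*[1+c]≡a+b∸2*c a b c) ⟨
  4 ^ suc c * ((suc a + suc b ∸ 2 * suc c) C (suc a ∸ suc c)) ∎)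
  where G : Table
        G = [4xy]^ c [x+y]^ m

data HasShape (k c : ℕ) (F : Table) : Set where
  vanishing : F ≋ 0ₜ → HasShape k c F
  scaled    : ∀ m → F ≋ k ⋆ [4xy]^ c [x+y]^ m → HasShape k c F

HasShape-resp : ∀ {k c F G} → F ≋ G → HasShape k c G → HasShape k c F
HasShape-resp F≋G (vanishing G≋0) = vanishing (λ a b → trans (F≋G a b) (G≋0 a b))
HasShape-resp F≋G (scaled m G≋)   = scaled m (λ a b → trans (F≋G a b) (G≋ a b))

HasShape-⋆ : ∀ {c F} k → HasShape 1 c F → HasShape k c (k ⋆ F)
HasShape-⋆ k (vanishing F≋0) = vanishing (λ a b → trans (cong (k *_) (F≋0 a b)) (*-zeroʳ k))
HasShape-⋆ k (scaled m F≋)   = scaled m (λ a b → cong (k *_) (trans (F≋ a b) (*-identityˡ _)))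

HasShape-[x+y]· : ∀ {k c F} → HasShape k c F → HasShape k c ([x+y]· F)
HasShape-[x+y]· (vanishing F≋0) = vanishing ([x+y]·-0 F≋0)
HasShape-[x+y]· {k} {c} {F} (scaled m F≋) = scaled (suc m) λ a b → begin
  ([x+y]· F) a b                            ≡⟨ [x+y]·-cong F≋ a b ⟩
  ([x+y]· (k ⋆ [4xy]^ c [x+y]^ m)) a b      ≡⟨ [x+y]·-⋆ k _ a b ⟩
  k * ([x+y]· [4xy]^ c [x+y]^ m) a b        ≡⟨ cong (k *_) ([x+y]·[4xy]^[x+y]^ c m a b) ⟩
  k * ([4xy]^ c [x+y]^ suc m) a b           ∎

HasShape-2xy· : ∀ {c F} → HasShape 2 c F → HasShape 1 (suc c) (2 ⋆ x· y· F)
HasShape-2xy· (vanishing F≋0) = vanishing (λ a b → cong (2 *_) (x·-0 (y·-0 F≋0) a b))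
HasShape-2xy· {c} {F} (scaled m F≋) = scaled m λ a b → begin
  2 * (x· y· F) a b            ≡⟨ cong (2 *_) (x·-cong (y·-cong F≋) a b) ⟩
  2 * (x· y· (2 ⋆ G)) a b      ≡⟨ cong (2 *_) (x·-cong (y·-⋆ 2 G) a b) ⟩
  2 * (x· (2 ⋆ y· G)) a b      ≡⟨ cong (2 *_) (x·-⋆ 2 (y· G) a b) ⟩
  2 * (2 * (x· y· G) a b)      ≡⟨ *-assoc 2 2 ((x· y· G) a b) ⟨
  4 * (x· y· G) a b            ≡⟨ *-identityˡ _ ⟨
  1 * (4 * (x· y· G) a b)      ∎
  where G : Table
        G = [4xy]^ c [x+y]^ m

whenHead-A-AB^ : ∀ a k → whenHead A (AB ^ʷ a) k ≡ shift (λ a′ → k (B ∷ AB ^ʷ a′)) a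
whenHead-A-AB^ zero    k = refl
whenHead-A-AB^ (suc a) k = refl

whenHead-B-AB^ : ∀ a k → whenHead B (AB ^ʷ a) k ≡ 0
whenHead-B-AB^ zero    k = refl
whenHead-B-AB^ (suc a) k = refl

-- A subscript 1 marks a factor that has emitted the A of its current AB and owes the B;
-- M¹ collects the two states in which exactly one B is owed.
M₀₀ M₀₁ M₁₀ M₁₁ M¹ : Word → Table
M₀₀ w a b = mult w (AB ^ʷ a) (AB ^ʷ b)
M₀₁ w a b = mult w (AB ^ʷ a) (B ∷ AB ^ʷ b)
M₁₀ w a b = mult w (B ∷ AB ^ʷ a) (AB ^ʷ b)
M₁₁ w a b = mult w (B ∷ AB ^ʷ a) (B ∷ AB ^ʷ b)
M¹ w = M₀₁ w ⊞ M₁₀ w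

M₀₀-[] : M₀₀ [] ≋ 1ₜ
M₀₀-[] zero    zero    = refl
M₀₀-[] zero    (suc b) = refl
M₀₀-[] (suc a) b       = mult-[]-∷ˡ A (B ∷ AB ^ʷ a) (AB ^ʷ b)

M₀₁-[] : M₀₁ [] ≋ 0ₜ
M₀₁-[] a b = mult-[]-∷ʳ B (AB ^ʷ a) (AB ^ʷ b)

M₁₀-[] : M₁₀ [] ≋ 0ₜ
M₁₀-[] a b = mult-[]-∷ˡ B (AB ^ʷ a) (AB ^ʷ b)

M₁₁-[] : M₁₁ [] ≋ 0ₜ
M₁₁-[] a b = mult-[]-∷ˡ B (AB ^ʷ a) (B ∷ AB ^ʷ b)

M₀₀-A : ∀ w → M₀₀ (A ∷ w) ≋ x· M₁₀ w ⊞ y· M₀₁ w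
M₀₀-A w a b = trans (mult-∷ A w (AB ^ʷ a) (AB ^ʷ b))
                    (cong₂ _+_ (whenHead-A-AB^ a _) (whenHead-A-AB^ b _))

M₀₀-B : ∀ w → M₀₀ (B ∷ w) ≋ 0ₜ
M₀₀-B w a b = trans (mult-∷ B w (AB ^ʷ a) (AB ^ʷ b))
                    (cong₂ _+_ (whenHead-B-AB^ a _) (whenHead-B-AB^ b _))

M₀₁-A : ∀ w → M₀₁ (A ∷ w) ≋ x· M₁₁ w
M₀₁-A w a b = trans (mult-∷ A w (AB ^ʷ a) (B ∷ AB ^ʷ b))
                    (trans (+-identityʳ _) (whenHead-A-AB^ a _))

M₀₁-B : ∀ w → M₀₁ (B ∷ w) ≋ M₀₀ w
M₀₁-B w a b = trans (mult-∷ B w (AB ^ʷ a) (B ∷ AB ^ʷ b))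
                    (cong (_+ M₀₀ w a b) (whenHead-B-AB^ a _))

M₁₀-A : ∀ w → M₁₀ (A ∷ w) ≋ y· M₁₁ w
M₁₀-A w a b = trans (mult-∷ A w (B ∷ AB ^ʷ a) (AB ^ʷ b))
                    (whenHead-A-AB^ b _)

M₁₀-B : ∀ w → M₁₀ (B ∷ w) ≋ M₀₀ w
M₁₀-B w a b = trans (mult-∷ B w (B ∷ AB ^ʷ a) (AB ^ʷ b))
                    (trans (cong (M₀₀ w a b +_) (whenHead-B-AB^ b _)) (+-identityʳ _))

M₁₁-A : ∀ w → M₁₁ (A ∷ w) ≋ 0ₜ
M₁₁-A w a b = mult-∷ A w (B ∷ AB ^ʷ a) (B ∷ AB ^ʷ b)

M₁₁-B : ∀ w → M₁₁ (B ∷ w) ≋ M¹ w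
M₁₁-B w a b = mult-∷ B w (B ∷ AB ^ʷ a) (B ∷ AB ^ʷ b)

M₀₀-A[] : M₀₀ (A ∷ []) ≋ 0ₜ
M₀₀-A[] a b = trans (M₀₀-A [] a b) (cong₂ _+_ (x·-0 M₁₀-[] a b) (y·-0 M₀₁-[] a b))

M₀₀-AA : ∀ w → M₀₀ (A ∷ A ∷ w) ≋ 2 ⋆ x· y· M₁₁ w
M₀₀-AA w a b = begin
  M₀₀ (A ∷ A ∷ w) a b                          ≡⟨ M₀₀-A (A ∷ w) a b ⟩
  (x· M₁₀ (A ∷ w)) a b + (y· M₀₁ (A ∷ w)) a b  ≡⟨ cong₂ _+_ (x·-cong (M₁₀-A w) a b)
                                                            (y·-cong (M₀₁-A w) a b) ⟩
  z + (y· x· M₁₁ w) a b                        ≡⟨ cong (z +_) (y·x·≋x·y· (M₁₁ w) a b) ⟩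
  z + z                                        ≡⟨ cong (z +_) (+-identityʳ z) ⟨
  2 * z                                        ∎
  where z : ℕ
        z = (x· y· M₁₁ w) a b

M₀₀-AB : ∀ w → M₀₀ (A ∷ B ∷ w) ≋ [x+y]· M₀₀ w
M₀₀-AB w a b =
  trans (M₀₀-A (B ∷ w) a b) (cong₂ _+_ (x·-cong (M₁₀-B w) a b) (y·-cong (M₀₁-B w) a b))

M¹-[] : M¹ [] ≋ 0ₜ
M¹-[] a b = cong₂ _+_ (M₀₁-[] a b) (M₁₀-[] a b)

M¹-A : ∀ w → M¹ (A ∷ w) ≋ [x+y]· M₁₁ w
M¹-A w a b = cong₂ _+_ (M₀₁-A w a b) (M₁₀-A w a b)

M¹-B : ∀ w → M¹ (B ∷ w) ≋ 2 ⋆ M₀₀ w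
M¹-B w a b =
  trans (cong₂ _+_ (M₀₁-B w a b) (M₁₀-B w a b)) (cong (M₀₀ w a b +_) (sym (+-identityʳ _)))

mutual
  M₀₀-shape : ∀ w → HasShape 1 (countAA w) (M₀₀ w)
  M₀₀-shape []          = scaled 0 (λ a b → trans (M₀₀-[] a b) (sym (*-identityˡ _)))
  M₀₀-shape (B ∷ w)     = vanishing (M₀₀-B w)
  M₀₀-shape (A ∷ [])    = vanishing M₀₀-A[]
  M₀₀-shape (A ∷ A ∷ w) = HasShape-resp (M₀₀-AA w) (HasShape-2xy· (M₁₁-shape w))
  M₀₀-shape (A ∷ B ∷ w) = HasShape-resp (M₀₀-AB w) (HasShape-[x+y]· (M₀₀-shape w))

  M¹-shape : ∀ w → HasShape 2 (countAA w) (M¹ w)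
  M¹-shape []      = vanishing M¹-[]
  M¹-shape (A ∷ w) = HasShape-resp (M¹-A w) (HasShape-[x+y]· (M₁₁-shape w))
  M¹-shape (B ∷ w) = HasShape-resp (M¹-B w) (HasShape-⋆ 2 (M₀₀-shape w))

  M₁₁-shape : ∀ w → HasShape 2 (countAA (A ∷ w)) (M₁₁ w)
  M₁₁-shape []      = vanishing M₁₁-[]
  M₁₁-shape (A ∷ w) = vanishing (M₁₁-A w)
  M₁₁-shape (B ∷ w) = HasShape-resp (M₁₁-B w) (M¹-shape w)

HasShape-1-coefficient : ∀ {c F} p q → HasShape 1 c F → F p q ≢ 0 →
  c ≤ p ⊓ q × F p q ≡ 4 ^ c * ((p + q ∸ 2 * c) C (p ∸ c))
HasShape-1-coefficient p q (vanishing F≋0) F≢0 = contradiction (F≋0 p q) F≢0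
HasShape-1-coefficient {c} {F} p q (scaled m F≋) F≢0 =
  map₂ (trans F≡G) ([4xy]^[x+y]^-coefficient c m p q (F≢0 ∘ trans F≡G))
  where F≡G : F p q ≡ ([4xy]^ c [x+y]^ m) p q
        F≡G = trans (F≋ p q) (*-identityˡ _)

Σ-peel : ∀ n (f : ℕ → Poly) → Σ[j≤ suc n ] f ≡ f 0 ⊕ Σ[j≤ n ] (f ∘ suc)
Σ-peel n f = cong (f 0 ⊕_) (begin
  foldr step 0P (applyUpTo suc (suc n))  ≡⟨ cong (foldr step 0P) (map-upTo suc (suc n)) ⟨
  foldr step 0P (map suc (upTo (suc n))) ≡⟨ foldr-map step suc 0P (upTo (suc n)) ⟩
  Σ[j≤ n ] (f ∘ suc)                     ∎)
  where step : ℕ → Poly → Poly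
        step j acc = f j ⊕ acc

Σ-vanishing : ∀ n (f : ℕ → Poly) w → (∀ j → f j w ≡ 0ℚ) → (Σ[j≤ n ] f) w ≡ 0ℚ
Σ-vanishing zero    f w f≡0 = trans (cong (ℚ._+ 0ℚ) (f≡0 0)) (ℚₚ.+-identityʳ 0ℚ)
Σ-vanishing (suc n) f w f≡0 = begin
  (Σ[j≤ suc n ] f) w                 ≡⟨ cong (λ P → P w) (Σ-peel n f) ⟩
  f 0 w ℚ.+ (Σ[j≤ n ] (f ∘ suc)) w   ≡⟨ cong₂ ℚ._+_ (f≡0 0)
                                                    (Σ-vanishing n (f ∘ suc) w (f≡0 ∘ suc)) ⟩
  0ℚ ℚ.+ 0ℚ                          ≡⟨ ℚₚ.+-identityʳ 0ℚ ⟩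
  0ℚ                                 ∎

Σ-single : ∀ {c} n (f : ℕ → Poly) w → c ≤ n → (∀ j → j ≢ c → f j w ≡ 0ℚ) →
           (Σ[j≤ n ] f) w ≡ f c w
Σ-single zero    f w z≤n f≡0 = ℚₚ.+-identityʳ (f 0 w)
Σ-single (suc n) f w z≤n f≡0 = begin
  (Σ[j≤ suc n ] f) w                 ≡⟨ cong (λ P → P w) (Σ-peel n f) ⟩
  f 0 w ℚ.+ (Σ[j≤ n ] (f ∘ suc)) w   ≡⟨ cong (f 0 w ℚ.+_)
                                            (Σ-vanishing n (f ∘ suc) w (λ j → f≡0 (suc j) λ ())) ⟩
  f 0 w ℚ.+ 0ℚ                       ≡⟨ ℚₚ.+-identityʳ (f 0 w) ⟩
  f 0 w                              ∎
Σ-single {suc c} (suc n) f w (s≤s c≤n) f≡0 = begin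
  (Σ[j≤ suc n ] f) w                 ≡⟨ cong (λ P → P w) (Σ-peel n f) ⟩
  f 0 w ℚ.+ (Σ[j≤ n ] (f ∘ suc)) w   ≡⟨ cong₂ ℚ._+_ (f≡0 0 λ ())
                                         (Σ-single n (f ∘ suc) w c≤n
                                           (λ j j≢c → f≡0 (suc j) (j≢c ∘ suc-injective))) ⟩
  0ℚ ℚ.+ f (suc c) w                 ≡⟨ ℚₚ.+-identityˡ (f (suc c) w) ⟩
  f (suc c) w                        ∎

·T-inS : ∀ k p q j w → inS p q j w ≡ true → (k · T p q j) w ≡ k
·T-inS k p q j w inS≡true =
  trans (cong (λ b → k ℚ.* (if b then 1ℚ else 0ℚ)) inS≡true) (ℚₚ.*-identityʳ k)

·T-∉S : ∀ k p q j w → inS p q j w ≡ false → (k · T p q j) w ≡ 0ℚ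
·T-∉S k p q j w inS≡false =
  trans (cong (λ b → k ℚ.* (if b then 1ℚ else 0ℚ)) inS≡false) (ℚₚ.*-zeroʳ k)

inS-absent : ∀ p q j w → M₀₀ w p q ≡ 0 → inS p q j w ≡ false
inS-absent p q j w N≡0 =
  cong (_∧ _) (dec-false (any? (w ≟W_) (shuffles (AB ^ʷ p) (AB ^ʷ q))) (count≡0⇒∉ _ N≡0))

inS-present : ∀ p q j w → M₀₀ w p q ≢ 0 → inS p q j w ≡ does (countAA w ≟ j)
inS-present p q j w N≢0 =
  cong (_∧ _) (dec-true (any? (w ≟W_) (shuffles (AB ^ʷ p) (AB ^ʷ q))) (count≢0⇒∈ _ N≢0))

mainTheorem3 : ∀ (p q : ℕ) →
    (AB ^ʷ p) ш (AB ^ʷ q) ≐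
      Σ[j≤ p ⊓ q ] (λ j → ℕ→ℚ (4 ^ j * ((p + q ∸ 2 * j) C (p ∸ j))) · T p q j)
mainTheorem3 p q w = by-cases (M₀₀ w p q ≟ 0)
  where
    coef : ℕ → ℕ
    coef j = 4 ^ j * ((p + q ∸ 2 * j) C (p ∸ j))

    term : ℕ → Poly
    term j = ℕ→ℚ (coef j) · T p q j

    by-cases : Dec (M₀₀ w p q ≡ 0) → ℕ→ℚ (M₀₀ w p q) ≡ (Σ[j≤ p ⊓ q ] term) w
    by-cases (yes N≡0) = trans (cong ℕ→ℚ N≡0) (sym (Σ-vanishing (p ⊓ q) term w
      λ j → ·T-∉S (ℕ→ℚ (coef j)) p q j w (inS-absent p q j w N≡0)))
    by-cases (no N≢0) with HasShape-1-coefficient p q (M₀₀-shape w) N≢0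
    ... | c≤p⊓q , N≡coef = begin
      ℕ→ℚ (M₀₀ w p q)        ≡⟨ cong ℕ→ℚ N≡coef ⟩
      ℕ→ℚ (coef c)           ≡⟨ ·T-inS (ℕ→ℚ (coef c)) p q c w
                                  (trans (inS-present p q c w N≢0) (dec-true (c ≟ c) refl)) ⟨
      term c w               ≡⟨ Σ-single (p ⊓ q) term w c≤p⊓q off-diagonal ⟨
      (Σ[j≤ p ⊓ q ] term) w  ∎
      where
        c : ℕ
        c = countAA w
        off-diagonal : ∀ j → j ≢ c → term j w ≡ 0ℚ
        off-diagonal j j≢c = ·T-∉S (ℕ→ℚ (coef j)) p q j w
          (trans (inS-present p q j w N≢0) (dec-false (c ≟ j) (j≢c ∘ sym)))
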